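{- Let $k$ be a positive integer with $k\equiv 3 \pmod 5$. Then $va_3^{\equiv}(K_{4k,4k,4k})\geq \frac{12k+4}{5}$.
   Context: All graphs are finite and simple. A $t$-coloring of a graph $G$ is a map $f:V(G)\to\{1,\dots,t\}$, with color classes $V_i=\{v: f(v)=i\}$. It is equitable if $\big||V_i|-|V_j|\big|\le 1$ for all $i,j$. A $(t,k)$-tree-coloring of $G$ is a $t$-coloring such that every connected component of each induced subgraph $G[V_i]$ is a tree of maximum degree at most $k$; an equitable $(t,k)$-tree-coloring is a $(t,k)$-tree-coloring that is equitable. The strong equitable vertex $k$-arboricity $va_k^{\equiv}(G)$ is the smallest integer $t$ such that $G$ has an equitable $(t',k)$-tree-coloring for every integer $t'\ge t$. $K_{n,n,n}$ denotes the complete tripartite graph whose three partite sets each have exactly $n$ vertices. -}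

module Defs where

open import Data.Nat using (ℕ; zero; suc; _+_; _*_; _≤_; _≥_)
open import Data.Fin using (Fin; zero; suc; inject₁; fromℕ; quotient)
open import Data.Fin.Properties using (_≟_)
open import Data.Bool using (Bool; true; false; not; _∧_)
open import Data.List using (List; length; filter; allFin)
open import Data.Product using (Σ; _×_; _,_)
open import Relation.Nullary using (¬_; yes; no)
open import Relation.Nullary.Decidable using (⌊_⌋)
open import Relation.Binary.PropositionalEquality using (_≡_; refl)
open import Function.Definitions using (Injective)

record Graph : Set where
  field
    n      : ℕ
    adj    : Fin n → Fin n → Bool
    sym    : ∀ u v → adj u v ≡ adj v u
    irrefl : ∀ v → adj v v ≡ false
open Graph public

Coloring : Graph → ℕ → Set
Coloring G t = Fin (n G) → Fin t

classSize : (G : Graph) {t : ℕ} → Coloring G t → Fin t → ℕ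
classSize G f c = length (filter (λ v → f v ≟ c) (allFin (n G)))

Equitable : (G : Graph) {t : ℕ} → Coloring G t → Set
Equitable G {t} f = ∀ (i j : Fin t) → classSize G f i ≤ suc (classSize G f j)

classDegree : (G : Graph) {t : ℕ} → Coloring G t → Fin (n G) → ℕ
classDegree G f v =
  length (filter (λ u → adj G v u Data.Bool.≟ true)
    (filter (λ u → f u ≟ f v) (allFin (n G))))
  where import Data.Bool

-- A cycle of length m+3 in G all of whose vertices have the same color,
-- i.e. a cycle in some induced subgraph G[V_i]: distinct vertices
-- p 0, ..., p (m+2), consecutive ones adjacent, and p (m+2) adjacent to p 0.
record MonoCycle (G : Graph) {t : ℕ} (f : Coloring G t) : Set where
  field
    m      : ℕ
    p      : Fin (suc (suc (suc m))) → Fin (n G)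
    inj    : Injective _≡_ _≡_ p
    step   : ∀ (i : Fin (suc (suc m))) → adj G (p (inject₁ i)) (p (suc i)) ≡ true
    close  : adj G (p (fromℕ (suc (suc m)))) (p zero) ≡ true
    mono   : ∀ i → f (p i) ≡ f (p zero)

-- (t,k)-tree-coloring: every component of every G[V_i] is a tree of max
-- degree ≤ k, i.e. every G[V_i] is acyclic (a forest) with max degree ≤ k.
TreeColoring : (G : Graph) (t k : ℕ) → Coloring G t → Set
TreeColoring G t k f = (¬ MonoCycle G f) × (∀ v → classDegree G f v ≤ k)

EquitableTreeColorable : (G : Graph) (t k : ℕ) → Set
EquitableTreeColorable G t k =
  Σ (Coloring G t) λ f → TreeColoring G t k f × Equitable G f

-- "t is admissible": G has an equitable (t',k)-tree-coloring for every t' ≥ t.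
-- va_k^≡(G) is the least admissible t.
StrongEqAdmissible : (G : Graph) (k t : ℕ) → Set
StrongEqAdmissible G k t = ∀ t' → t' ≥ t → EquitableTreeColorable G t' k

-- complete tripartite graph K_{n,n,n}: vertex v ∈ Fin (3 * n) lies in part
-- quotient n v ∈ Fin 3; two vertices are adjacent iff in different parts.
private
  diffAdj : ∀ {N} (g : Fin N → Fin 3) → Fin N → Fin N → Bool
  diffAdj g u v = not ⌊ g u ≟ g v ⌋

  diffSym : ∀ {N} (g : Fin N → Fin 3) u v → diffAdj g u v ≡ diffAdj g v u
  diffSym g u v with g u ≟ g v | g v ≟ g u
  ... | yes _ | yes _ = refl
  ... | no _  | no _  = refl
  ... | yes e | no ne = Data.Empty.⊥-elim (ne (Relation.Binary.PropositionalEquality.sym e))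
    where import Data.Empty
  ... | no ne | yes e = Data.Empty.⊥-elim (ne (Relation.Binary.PropositionalEquality.sym e))
    where import Data.Empty

  diffIrr : ∀ {N} (g : Fin N → Fin 3) v → diffAdj g v v ≡ false
  diffIrr g v with g v ≟ g v
  ... | yes _ = refl
  ... | no ne = Data.Empty.⊥-elim (ne refl)
    where import Data.Empty

K3 : ℕ → Graph
K3 k = record
  { n = 3 * k
  ; adj = diffAdj (quotient {3} k)
  ; sym = diffSym (quotient {3} k)
  ; irrefl = diffIrr (quotient {3} k)
  }

module Submission where

-- Write k = 5q + 3 and t′ = 12q + 7, so that 3 · 4k = 5t′ + 1. If some t ≤ t′ were admissible,
-- K_{4k,4k,4k} would have an equitable (t′,3)-tree-coloring, and all its classes would have at
-- least 5 vertices. A vertex u is adjacent to every vertex of its class outside its own part, so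
-- degree ≤ 3 puts at least two vertices of its class into u's part; a class meeting two parts
-- would then contain a 4-cycle. Hence every class lies inside one part. The class sizes exceed 5
-- by 1 in total, so some part is a union of 5-element classes and 5 ∣ 4k, against k ≡ 3 (mod 5).

open import Defs hiding (sym)
open import Data.Nat using (ℕ; zero; suc; _+_; _*_; _∸_; _%_; _≤_; _<_; NonZero; z≤n; s≤s; s≤s⁻¹; _≤?_)
open import Data.Nat.Properties hiding (_≟_)
open import Data.Nat.Divisibility using (_∣_; m∣m*n; n∣m*n; ∣m∣n⇒∣m+n; ∣m+n∣m⇒∣n; ∣⇒≤; _∣0)
open import Data.Nat.DivMod using (_/_; m≡m%n+[m/n]*n)
open import Data.Nat.Tactic.RingSolver using (solve-∀)
open import Data.Fin using (Fin; zero; suc; quotient; inject₁; _↑ˡ_; _↑ʳ_)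
open import Data.Fin.Properties using (_≟_; splitAt-↑ˡ; splitAt-↑ʳ)
import Data.Fin.Properties as Fin
open import Data.Bool using (true; false; not; if_then_else_) renaming (_≟_ to _≟ᵇ_)
open import Data.List using ([]; _∷_; length; filter; tabulate; allFin)
open import Data.Vec using (Vec; []; _∷_; lookup)
open import Data.Vec.Relation.Unary.All using ([]; _∷_)
open import Data.Vec.Relation.Unary.AllPairs using ([]; _∷_)
open import Data.Vec.Relation.Unary.Unique.Propositional using (Unique)
open import Data.Vec.Relation.Unary.Unique.Propositional.Properties using (lookup-injective)
open import Data.Product using (_×_; _,_; proj₁; proj₂; ∃; ∃₂)
open import Data.Sum using (_⊎_; inj₁; inj₂)
open import Data.Empty using (⊥-elim)
open import Relation.Nullary using (¬_; Dec; yes; no; does)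
open import Relation.Nullary.Decidable using (_×-dec_; isYes≗does; dec-false)
open import Relation.Unary using (Decidable)
open import Function using (_∘_)
open import Relation.Binary.PropositionalEquality
open import Algebra.Properties.Semiring.Sum +-*-semiring
  using (sum; sum-syntax; ∑-comm; ∑-distrib-+; sum-cong-≗; *-distribˡ-sum; *-distribʳ-sum; sum-replicate-zero)

-- Defined through does, so that χ (suc i ≟ suc j) reduces to χ (i ≟ j).
χ : {A : Set} → Dec A → ℕ
χ d = if does d then 1 else 0

count : ∀ {N} {P : Fin N → Set} → Decidable P → ℕ
count {N} P? = ∑[ i < N ] χ (P? i)

∑-const : ∀ n x → ∑[ i < n ] x ≡ n * x
∑-const zero    x = refl
∑-const (suc n) x = cong (x +_) (∑-const n x)

∑-mono-≤ : ∀ {n} {g h : Fin n → ℕ} → (∀ i → g i ≤ h i) → sum g ≤ sum h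
∑-mono-≤ {zero}  g≤h = z≤n
∑-mono-≤ {suc n} g≤h = +-mono-≤ (g≤h zero) (∑-mono-≤ (λ i → g≤h (suc i)))

∑-++ : ∀ a b (g : Fin (a + b) → ℕ) →
       sum g ≡ ∑[ i < a ] g (i ↑ˡ b) + ∑[ j < b ] g (a ↑ʳ j)
∑-++ zero    b g = refl
∑-++ (suc a) b g = trans (cong (g zero +_) (∑-++ a b (λ i → g (suc i))))
                         (sym (+-assoc (g zero) _ _))

∑-select : ∀ {t} (x : Fin t) (h : Fin t → ℕ) → ∑[ c < t ] (χ (x ≟ c) * h c) ≡ h x
∑-select {suc t} zero    h = begin
  h zero + 0 + ∑[ c < t ] 0 ≡⟨ cong₂ _+_ (+-identityʳ (h zero)) (sum-replicate-zero t) ⟩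
  h zero + 0                ≡⟨ +-identityʳ (h zero) ⟩
  h zero                    ∎
  where open ≡-Reasoning
∑-select {suc t} (suc x) h = ∑-select x (λ c → h (suc c))

∑-<-* : ∀ {t} (g : Fin t → ℕ) {a} c → (∀ i → g i ≤ a) → g c < a → sum g < t * a
∑-<-* {suc t} g {a} zero g≤a gc<a =
  +-mono-<-≤ gc<a (≤-trans (∑-mono-≤ (λ i → g≤a (suc i))) (≤-reflexive (∑-const t a)))
∑-<-* g (suc c) g≤a gc<a =
  +-mono-≤-< (g≤a zero) (∑-<-* (λ i → g (suc i)) c (λ i → g≤a (suc i)) gc<a)

χ-≤-+ : {A B C : Set} (a? : Dec A) (b? : Dec B) (c? : Dec C) →
        (A → B ⊎ C) → χ a? ≤ χ b? + χ c?
χ-≤-+ (no _)  _       _       _   = z≤n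
χ-≤-+ (yes _) (yes _) _       _   = s≤s z≤n
χ-≤-+ (yes _) (no _)  (yes _) _   = s≤s z≤n
χ-≤-+ (yes a) (no ¬b) (no ¬c) a⇒b∨c with a⇒b∨c a
... | inj₁ b = ⊥-elim (¬b b)
... | inj₂ c = ⊥-elim (¬c c)

count-≤-+ : ∀ {N} {A B C : Fin N → Set}
            (A? : Decidable A) (B? : Decidable B) (C? : Decidable C) →
            (∀ i → A i → B i ⊎ C i) → count A? ≤ count B? + count C?
count-≤-+ A? B? C? A⇒B∨C = begin
  count A?                               ≤⟨ ∑-mono-≤ (λ i → χ-≤-+ (A? i) (B? i) (C? i) (A⇒B∨C i)) ⟩
  ∑[ i < _ ] (χ (B? i) + χ (C? i))       ≡⟨ ∑-distrib-+ (λ i → χ (B? i)) (λ i → χ (C? i)) ⟩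
  count B? + count C?                    ∎
  where open ≤-Reasoning

0<count⇒∃ : ∀ {N} {P : Fin N → Set} (P? : Decidable P) → 0 < count P? → ∃ P
0<count⇒∃ {suc N} P? 0<count with P? zero
... | yes p = zero , p
... | no _ with 0<count⇒∃ (λ i → P? (suc i)) 0<count
...   | i , p = suc i , p

2≤count⇒∃≢ : ∀ {N} {P : Fin N → Set} (P? : Decidable P) →
             2 ≤ count P? → ∃₂ λ i j → i ≢ j × P i × P j
2≤count⇒∃≢ {suc N} P? 2≤count with P? zero
... | yes p with 0<count⇒∃ (λ i → P? (suc i)) (s≤s⁻¹ 2≤count)
...   | j , q = zero , suc j , (λ ()) , p , q
2≤count⇒∃≢ {suc N} P? 2≤count | no _ with 2≤count⇒∃≢ (λ i → P? (suc i)) 2≤count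
...   | i , j , i≢j , p , q = suc i , suc j , (λ eq → i≢j (Fin.suc-injective eq)) , p , q

∑≡1⇒∃≡0 : ∀ {p} (g : Fin (suc (suc p)) → ℕ) → sum g ≡ 1 → ∃ λ i → g i ≡ 0
∑≡1⇒∃≡0 g ∑≡1 with g zero in g₀
... | zero  = zero , g₀
... | suc m = suc zero , m+n≡0⇒m≡0 (g (suc zero)) (m+n≡0⇒n≡0 m (suc-injective ∑≡1))

module _ {A : Set} {P Q : A → Set} (P? : Decidable P) (Q? : Decidable Q) where

  filter-filter : ∀ xs → filter Q? (filter P? xs) ≡ filter (λ x → P? x ×-dec Q? x) xs
  filter-filter []       = refl
  filter-filter (x ∷ xs) with does (P? x)
  ... | false = filter-filter xs
  ... | true with does (Q? x)
  ...   | false = filter-filter xs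
  ...   | true  = cong (x ∷_) (filter-filter xs)

length-filter-tabulate : ∀ {A : Set} {P : A → Set} (P? : Decidable P) {n} (g : Fin n → A) →
                         length (filter P? (tabulate g)) ≡ ∑[ i < n ] χ (P? (g i))
length-filter-tabulate P? {zero}  g = refl
length-filter-tabulate P? {suc n} g with does (P? (g zero))
... | false = length-filter-tabulate P? (λ i → g (suc i))
... | true  = cong suc (length-filter-tabulate P? (λ i → g (suc i)))

fibreSum : ∀ {t p} → (Fin t → Fin p) → (Fin t → ℕ) → Fin p → ℕ
fibreSum {t} π s P = ∑[ c < t ] (s c * χ (π c ≟ P))

∑-fibreSum : ∀ {t p} (π : Fin t → Fin p) (s : Fin t → ℕ) → ∑[ P < p ] fibreSum π s P ≡ sum s
∑-fibreSum {t} {p} π s = begin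
  ∑[ P < p ] ∑[ c < t ] (s c * χ (π c ≟ P))  ≡⟨ ∑-comm (λ P c → s c * χ (π c ≟ P)) ⟩
  ∑[ c < t ] ∑[ P < p ] (s c * χ (π c ≟ P))  ≡⟨ sum-cong-≗ (λ c → sum-cong-≗ (λ P → *-comm (s c) (χ (π c ≟ P)))) ⟩
  ∑[ c < t ] ∑[ P < p ] (χ (π c ≟ P) * s c)  ≡⟨ sum-cong-≗ (λ c → ∑-select (π c) (λ _ → s c)) ⟩
  sum s                                      ∎
  where open ≡-Reasoning

∑-fibres : ∀ {N t} (f : Fin N → Fin t) (h : Fin t → ℕ) →
           ∑[ v < N ] h (f v) ≡ ∑[ c < t ] (count (λ v → f v ≟ c) * h c)
∑-fibres {N} {t} f h = begin
  ∑[ v < N ] h (f v)                          ≡⟨ sum-cong-≗ (λ v → ∑-select (f v) h) ⟨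
  ∑[ v < N ] ∑[ c < t ] (χ (f v ≟ c) * h c)   ≡⟨ ∑-comm (λ v c → χ (f v ≟ c) * h c) ⟩
  ∑[ c < t ] ∑[ v < N ] (χ (f v ≟ c) * h c)   ≡⟨ sum-cong-≗ (λ c → *-distribʳ-sum (h c) (λ v → χ (f v ≟ c))) ⟨
  ∑[ c < t ] (count (λ v → f v ≟ c) * h c)    ∎
  where open ≡-Reasoning

some-fibreSum-divisible : ∀ {t p} m (s : Fin t → ℕ) (π : Fin t → Fin (suc (suc p))) →
                          (∀ c → m ≤ s c) → sum s ≡ m * t + 1 →
                          ∃ λ P → m ∣ fibreSum π s P
some-fibreSum-divisible {t} {p} m s π m≤s ∑s≡mt+1 = P , divisible
  where
  excess : Fin t → ℕ
  excess c = s c ∸ m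

  s≡m+excess : ∀ c → s c ≡ m + excess c
  s≡m+excess c = sym (m+[n∸m]≡n (m≤s c))

  ∑excess≡1 : sum excess ≡ 1
  ∑excess≡1 = +-cancelˡ-≡ (m * t) _ _ (begin
    m * t + sum excess                 ≡⟨ cong (_+ sum excess) (trans (*-comm m t) (sym (∑-const t m))) ⟩
    ∑[ c < t ] m + sum excess          ≡⟨ ∑-distrib-+ (λ _ → m) excess ⟨
    ∑[ c < t ] (m + excess c)          ≡⟨ sum-cong-≗ s≡m+excess ⟨
    sum s                              ≡⟨ ∑s≡mt+1 ⟩
    m * t + 1                          ∎)
    where open ≡-Reasoning

  emptyBlock : ∃ λ P → fibreSum π excess P ≡ 0
  emptyBlock = ∑≡1⇒∃≡0 (fibreSum π excess) (trans (∑-fibreSum π excess) ∑excess≡1)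

  P : Fin (suc (suc p))
  P = proj₁ emptyBlock

  fibreSum-s : fibreSum π s P ≡ m * ∑[ c < t ] χ (π c ≟ P) + fibreSum π excess P
  fibreSum-s = begin
    ∑[ c < t ] (s c * χ (π c ≟ P))
      ≡⟨ sum-cong-≗ (λ c → cong (_* χ (π c ≟ P)) (s≡m+excess c)) ⟩
    ∑[ c < t ] ((m + excess c) * χ (π c ≟ P))
      ≡⟨ sum-cong-≗ (λ c → *-distribʳ-+ (χ (π c ≟ P)) m (excess c)) ⟩
    ∑[ c < t ] (m * χ (π c ≟ P) + excess c * χ (π c ≟ P))
      ≡⟨ ∑-distrib-+ (λ c → m * χ (π c ≟ P)) (λ c → excess c * χ (π c ≟ P)) ⟩
    ∑[ c < t ] (m * χ (π c ≟ P)) + fibreSum π excess P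
      ≡⟨ cong (_+ fibreSum π excess P) (*-distribˡ-sum m (λ c → χ (π c ≟ P))) ⟨
    m * ∑[ c < t ] χ (π c ≟ P) + fibreSum π excess P
      ∎
    where open ≡-Reasoning

  divisible : m ∣ fibreSum π s P
  divisible = subst (m ∣_) (sym fibreSum-s)
    (∣m∣n⇒∣m+n (m∣m*n _) (subst (m ∣_) (sym (proj₂ emptyBlock)) (m ∣0)))

quotient-↑ˡ : ∀ m n (i : Fin n) → quotient {suc m} n (i ↑ˡ m * n) ≡ zero
quotient-↑ˡ m n i rewrite splitAt-↑ˡ n i (m * n) = refl

quotient-↑ʳ : ∀ m n (j : Fin (m * n)) → quotient {suc m} n (n ↑ʳ j) ≡ suc (quotient n j)
quotient-↑ʳ m n j rewrite splitAt-↑ʳ n (m * n) j = refl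

count-quotient : ∀ m n (P : Fin m) → count (λ v → quotient {m} n v ≟ P) ≡ n
count-quotient (suc m) n P = begin
  count (λ v → quotient n v ≟ P)
    ≡⟨ ∑-++ n (m * n) (λ v → χ (quotient n v ≟ P)) ⟩
  ∑[ i < n ] χ (quotient n (i ↑ˡ m * n) ≟ P) + ∑[ j < m * n ] χ (quotient n (n ↑ʳ j) ≟ P)
    ≡⟨ cong₂ _+_ (sum-cong-≗ (λ i → cong (λ Q → χ (Q ≟ P)) (quotient-↑ˡ m n i)))
                 (sum-cong-≗ (λ j → cong (λ Q → χ (Q ≟ P)) (quotient-↑ʳ m n j))) ⟩
  ∑[ i < n ] χ (zero ≟ P) + ∑[ j < m * n ] χ (suc (quotient n j) ≟ P)
    ≡⟨ blocks P ⟩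
  n ∎
  where
  open ≡-Reasoning
  blocks : ∀ P → ∑[ i < n ] χ (zero ≟ P) + ∑[ j < m * n ] χ (suc (quotient n j) ≟ P) ≡ n
  blocks zero = begin
    ∑[ i < n ] 1 + ∑[ j < m * n ] 0  ≡⟨ cong₂ _+_ (∑-const n 1) (sum-replicate-zero (m * n)) ⟩
    n * 1 + 0                        ≡⟨ trans (+-identityʳ (n * 1)) (*-identityʳ n) ⟩
    n                                ∎
  blocks (suc P) = begin
    ∑[ i < n ] 0 + count (λ j → quotient n j ≟ P)  ≡⟨ cong₂ _+_ (sum-replicate-zero n) (count-quotient m n P) ⟩
    0 + n                                          ∎

classSize≡count : ∀ G {t} (f : Coloring G t) c → classSize G f c ≡ count (λ v → f v ≟ c)
classSize≡count G f c = length-filter-tabulate (λ v → f v ≟ c) (λ v → v)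

∑-classSize : ∀ G {t} (f : Coloring G t) → ∑[ c < t ] classSize G f c ≡ n G
∑-classSize G {t} f = begin
  ∑[ c < t ] classSize G f c                   ≡⟨ sum-cong-≗ (λ c → trans (classSize≡count G f c) (sym (*-identityʳ _))) ⟩
  ∑[ c < t ] (count (λ v → f v ≟ c) * 1)       ≡⟨ ∑-fibres f (λ _ → 1) ⟨
  ∑[ v < n G ] 1                               ≡⟨ trans (∑-const (n G) 1) (*-identityʳ (n G)) ⟩
  n G                                          ∎
  where open ≡-Reasoning

equitable⇒classSize-≥ : ∀ G {t} {f : Coloring G t} → Equitable G f →
                        ∀ m → m * t ≤ n G → ∀ c → m ≤ classSize G f c
equitable⇒classSize-≥ G {t} {f} equitable m mt≤n c with m ≤? classSize G f c
... | yes m≤size = m≤size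
... | no m≰size = ⊥-elim (<⇒≱ ∑size<tm (begin
  t * m                       ≡⟨ *-comm t m ⟩
  m * t                       ≤⟨ mt≤n ⟩
  n G                         ≡⟨ ∑-classSize G f ⟨
  ∑[ c < t ] classSize G f c  ∎))
  where
  open ≤-Reasoning
  size<m : classSize G f c < m
  size<m = ≰⇒> m≰size
  ∑size<tm : ∑[ c < t ] classSize G f c < t * m
  ∑size<tm = ∑-<-* (classSize G f) c (λ j → ≤-trans (equitable j c) size<m) size<m

adj-K3 : ∀ n {u v : Fin (3 * n)} → quotient {3} n u ≢ quotient n v → adj (K3 n) u v ≡ true
adj-K3 n {u} {v} parts≢ = cong not (trans (isYes≗does parts≟) (dec-false parts≟ parts≢))
  where parts≟ = quotient {3} n u ≟ quotient n v

module _ {n t : ℕ} (f : Coloring (K3 n) t) where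

  part : Fin (3 * n) → Fin 3
  part = quotient n

  ColouredIn : Fin t → Fin 3 → Fin (3 * n) → Set
  ColouredIn c P x = f x ≡ c × part x ≡ P

  colouredIn? : ∀ c P → Decidable (ColouredIn c P)
  colouredIn? c P x = f x ≟ c ×-dec part x ≟ P

  square : ∀ {c} {P Q : Fin 3} → P ≢ Q →
           (∃₂ λ u u' → u ≢ u' × ColouredIn c P u × ColouredIn c P u') →
           (∃₂ λ v v' → v ≢ v' × ColouredIn c Q v × ColouredIn c Q v') →
           MonoCycle (K3 n) f
  square {P = P} {Q} P≢Q (u , u' , u≢u' , (fu , pu) , (fu' , pu')) (v , v' , v≢v' , (fv , pv) , (fv' , pv')) =
    record { m = 1 ; p = lookup xs ; inj = λ {i} {j} → lookup-injective distinct i j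
           ; step = step ; close = adj-K3 n (apart pu pv' ∘ sym) ; mono = mono }
    where
    xs : Vec (Fin (3 * n)) 4
    xs = u ∷ v ∷ u' ∷ v' ∷ []

    apart : ∀ {x y} → part x ≡ P → part y ≡ Q → part x ≢ part y
    apart px py eq = P≢Q (trans (sym px) (trans eq py))

    ≢-from-parts : ∀ {x y} → part x ≡ P → part y ≡ Q → x ≢ y
    ≢-from-parts px py eq = apart px py (cong part eq)

    distinct : Unique xs
    distinct = (≢-from-parts pu pv ∷ u≢u' ∷ ≢-from-parts pu pv' ∷ [])
             ∷ ((≢-from-parts pu' pv ∘ sym) ∷ v≢v' ∷ [])
             ∷ (≢-from-parts pu' pv' ∷ [])
             ∷ [] ∷ []

    step : ∀ i → adj (K3 n) (lookup xs (inject₁ i)) (lookup xs (suc i)) ≡ true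
    step zero             = adj-K3 n (apart pu pv)
    step (suc zero)       = adj-K3 n (apart pu' pv ∘ sym)
    step (suc (suc zero)) = adj-K3 n (apart pu' pv')

    mono : ∀ i → f (lookup xs i) ≡ f u
    mono zero                   = refl
    mono (suc zero)             = trans fv (sym fu)
    mono (suc (suc zero))       = trans fu' (sym fu)
    mono (suc (suc (suc zero))) = trans fv' (sym fu)

  sameColourNeighbour? : ∀ u → Decidable (λ x → f x ≡ f u × adj (K3 n) u x ≡ true)
  sameColourNeighbour? u x = f x ≟ f u ×-dec adj (K3 n) u x ≟ᵇ true

  classDegree≡count : ∀ u → classDegree (K3 n) f u ≡ count (sameColourNeighbour? u)
  classDegree≡count u =
    trans (cong length (filter-filter (λ x → f x ≟ f u) (λ x → adj (K3 n) u x ≟ᵇ true) (allFin (3 * n))))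
          (length-filter-tabulate (sameColourNeighbour? u) (λ x → x))

  classSize≤classDegree+count-colouredIn : ∀ {c} u → f u ≡ c →
    classSize (K3 n) f c ≤ classDegree (K3 n) f u + count (colouredIn? c (part u))
  classSize≤classDegree+count-colouredIn {c} u fu≡c = begin
    classSize (K3 n) f c
      ≡⟨ classSize≡count (K3 n) f c ⟩
    count (λ x → f x ≟ c)
      ≤⟨ count-≤-+ (λ x → f x ≟ c) (sameColourNeighbour? u) (colouredIn? c (part u)) neighbourOrSamePart ⟩
    count (sameColourNeighbour? u) + count (colouredIn? c (part u))
      ≡⟨ cong (_+ count (colouredIn? c (part u))) (classDegree≡count u) ⟨
    classDegree (K3 n) f u + count (colouredIn? c (part u))
      ∎
    where
    open ≤-Reasoning
    neighbourOrSamePart : ∀ x → f x ≡ c → (f x ≡ f u × adj (K3 n) u x ≡ true) ⊎ ColouredIn c (part u) x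
    neighbourOrSamePart x fx≡c with part x ≟ part u
    ... | yes same  = inj₂ (fx≡c , same)
    ... | no differ = inj₁ (trans fx≡c (sym fu≡c) , adj-K3 n (differ ∘ sym))

  2≤count-colouredIn : TreeColoring (K3 n) t 3 f → ∀ {c} u → f u ≡ c → 5 ≤ classSize (K3 n) f c →
                       2 ≤ count (colouredIn? c (part u))
  2≤count-colouredIn (_ , degree≤3) {c} u fu≡c 5≤size = +-cancelˡ-≤ 3 2 _ (begin
    5                                                        ≤⟨ 5≤size ⟩
    classSize (K3 n) f c                                     ≤⟨ classSize≤classDegree+count-colouredIn u fu≡c ⟩
    classDegree (K3 n) f u + count (colouredIn? c (part u))  ≤⟨ +-monoˡ-≤ _ (degree≤3 u) ⟩
    3 + count (colouredIn? c (part u))                       ∎)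
    where open ≤-Reasoning

  sameColour⇒samePart : TreeColoring (K3 n) t 3 f → (∀ c → 5 ≤ classSize (K3 n) f c) →
                        ∀ {u v} → f u ≡ f v → part u ≡ part v
  sameColour⇒samePart treeColoring 5≤size {u} {v} fu≡fv with part u ≟ part v
  ... | yes same   = same
  ... | no differ = ⊥-elim (proj₁ treeColoring (square differ (twoInPart u refl) (twoInPart v (sym fu≡fv))))
    where
    twoInPart : ∀ x → f x ≡ f u →
                ∃₂ λ y y' → y ≢ y' × ColouredIn (f u) (part x) y × ColouredIn (f u) (part x) y'
    twoInPart x fx≡fu =
      2≤count⇒∃≢ (colouredIn? (f u) (part x)) (2≤count-colouredIn treeColoring x fx≡fu (5≤size (f u)))

  module _ (treeColoring : TreeColoring (K3 n) t 3 f) (5≤size : ∀ c → 5 ≤ classSize (K3 n) f c) where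

    representative : ∀ c → ∃ λ v → f v ≡ c
    representative c = 0<count⇒∃ (λ v → f v ≟ c)
      (≤-trans (s≤s z≤n) (subst (5 ≤_) (classSize≡count (K3 n) f c) (5≤size c)))

    colourPart : Fin t → Fin 3
    colourPart c = part (proj₁ (representative c))

    part≡colourPart : ∀ v → part v ≡ colourPart (f v)
    part≡colourPart v = sameColour⇒samePart treeColoring 5≤size (sym (proj₂ (representative (f v))))

    partSize≡fibreSum : ∀ P → n ≡ fibreSum colourPart (classSize (K3 n) f) P
    partSize≡fibreSum P = begin
      n                                               ≡⟨ count-quotient 3 n P ⟨
      count (λ v → part v ≟ P)                        ≡⟨ sum-cong-≗ (λ v → cong (λ Q → χ (Q ≟ P)) (part≡colourPart v)) ⟩
      ∑[ v < 3 * n ] χ (colourPart (f v) ≟ P)         ≡⟨ ∑-fibres f (λ c → χ (colourPart c ≟ P)) ⟩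
      ∑[ c < t ] (count (λ v → f v ≟ c) * χ (colourPart c ≟ P))
        ≡⟨ sum-cong-≗ (λ c → cong (_* χ (colourPart c ≟ P)) (classSize≡count (K3 n) f c)) ⟨
      fibreSum colourPart (classSize (K3 n) f) P      ∎
      where open ≡-Reasoning

K3-equitable-tree-coloring⇒5∣ : ∀ {n t} → EquitableTreeColorable (K3 n) t 3 →
                                3 * n ≡ 5 * t + 1 → 5 ∣ n
K3-equitable-tree-coloring⇒5∣ {n} {t} (f , treeColoring , equitable) 3n≡5t+1 =
  let P , 5∣fibreSum = some-fibreSum-divisible 5 (classSize (K3 n) f) (colourPart {n} f treeColoring 5≤size)
                         5≤size (trans (∑-classSize (K3 n) f) 3n≡5t+1)
  in subst (5 ∣_) (sym (partSize≡fibreSum {n} f treeColoring 5≤size P)) 5∣fibreSum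
  where
  5≤size : ∀ c → 5 ≤ classSize (K3 n) f c
  5≤size = equitable⇒classSize-≥ (K3 n) equitable 5 (subst (5 * t ≤_) (sym 3n≡5t+1) (m≤m+n (5 * t) 1))

m%n≡r⇒m≡r+q*n : ∀ m n .{{_ : NonZero n}} {r} → m % n ≡ r → ∃ λ q → m ≡ r + q * n
m%n≡r⇒m≡r+q*n m n m%n≡r = m / n , trans (m≡m%n+[m/n]*n m n) (cong (_+ (m / n) * n) m%n≡r)

5∤2 : ¬ 5 ∣ 2
5∤2 5∣2 with ∣⇒≤ 5∣2
... | s≤s (s≤s ())

lemma4 : ∀ (k : ℕ) → .{{_ : NonZero k}} → k % 5 ≡ 3 →
    ∀ (t : ℕ) → StrongEqAdmissible (K3 (4 * k)) 3 t → 12 * k + 4 ≤ 5 * t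
lemma4 k k%5≡3 t admissible with m%n≡r⇒m≡r+q*n k 5 k%5≡3
... | q , refl with t ≤? 12 * q + 7
...   | yes t≤t′ = ⊥-elim (5∤2 (∣m+n∣m⇒∣n (subst (5 ∣_) (partSize q) 5∣partSize) (n∣m*n (4 * q + 2))))
  where
  vertexCount : ∀ q → 3 * (4 * (3 + q * 5)) ≡ 5 * (12 * q + 7) + 1
  vertexCount = solve-∀
  5∣partSize : 5 ∣ 4 * (3 + q * 5)
  5∣partSize = K3-equitable-tree-coloring⇒5∣ (admissible (12 * q + 7) t≤t′) (vertexCount q)
  partSize : ∀ q → 4 * (3 + q * 5) ≡ (4 * q + 2) * 5 + 2
  partSize = solve-∀
...   | no t≰t′ = subst (_≤ 5 * t) (bound q) (*-monoʳ-≤ 5 (≰⇒> t≰t′))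
  where
  bound : ∀ q → 5 * suc (12 * q + 7) ≡ 12 * (3 + q * 5) + 4
  bound = solve-∀
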